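{- Let $p$ be a prime, $n\ge1$, $f\in\mathbb{Z}[x]$, let $C$ be a cycle of size $k$ in $G(f,\mathbb{Z}_{p^n})$, and let $C'$ be a lifted cycle of $C$ in $G(f,\mathbb{Z}_{p^{n+1}})$. If the size of $C'$ equals $k$, then $\bar\lambda(C')=\bar\lambda(C)$. Otherwise, $\bar\lambda(C')=1$.
   Context: $\mathbb{Z}_N:=\mathbb{Z}/N\mathbb{Z}$; $f^i$ is the $i$-th iterate; $G(f,\mathbb{Z}_N)$ is the directed graph on $\mathbb{Z}_N$ with edges $(v,f(v))$. A cycle of size $k$ is a set of $k$ distinct vertices $v_0,\dots,v_{k-1}$ with $f(v_i)=v_{i+1}$ (indices mod $k$). With $\pi:\mathbb{Z}_{p^{n+1}}\to\mathbb{Z}_{p^n}$ the natural projection, the lifted graph of $C$ is the subgraph of $G(f,\mathbb{Z}_{p^{n+1}})$ induced on $\pi^{ -1}(C)$, and a lifted cycle of $C$ is a cycle in it. The multiplier of a cycle $D$ of size $k$ is $\lambda(D)=(f^k)'(v_0)=\prod_{v\in D}f'(v)$ (integer polynomial derivatives evaluated at representatives), and $\bar\lambda(D)$ is its image in $\mathbb{Z}_p$. -}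

module Defs where

open import Data.Nat using (ℕ; zero; suc; _<_; _%_; _^_)
open import Data.Integer using (ℤ; +_; _+_; _*_; _%ℕ_)
open import Data.List using (List; []; _∷_)
open import Data.Product using (Σ; _×_; ∃-syntax)
open import Relation.Binary.PropositionalEquality using (_≡_)

-- Integer polynomials: coefficient lists, constant term first
-- (a₀ ∷ a₁ ∷ … represents a₀ + a₁ x + …).
Poly : Set
Poly = List ℤ

eval : Poly → ℤ → ℤ
eval []       x = + 0
eval (a ∷ as) x = a + x * eval as x

derivAux : ℕ → Poly → Poly
derivAux i []       = []
derivAux i (b ∷ bs) = (+ i * b) ∷ derivAux (suc i) bs

deriv : Poly → Poly
deriv []       = []
deriv (a ∷ as) = derivAux 1 as

-- canonical representative in {0,…,N-1} of an integer mod N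
-- (N = 0 never occurs below, since we only use N = p^n with p prime)
red : ℕ → ℤ → ℕ
red zero    z = 0
red (suc m) z = z %ℕ suc m

-- the map f on ℤ_N, vertices represented by 0 … N-1
fMod : ℕ → Poly → ℕ → ℕ
fMod N f v = red N (eval f (+ v))

-- i mod k on ℕ (k = 0 never used: cycles have size ≥ 1)
modNat : ℕ → ℕ → ℕ
modNat zero    i = i
modNat (suc m) i = i % suc m

prodUpTo : ℕ → (ℕ → ℤ) → ℤ
prodUpTo zero    g = + 1
prodUpTo (suc k) g = prodUpTo k g * g k

record IsCycle (N : ℕ) (f : Poly) (k : ℕ) (c : ℕ → ℕ) : Set where
  field
    size-pos : 0 < k
    inRange  : ∀ i → i < k → c i < N
    distinct : ∀ i j → i < k → j < k → c i ≡ c j → i ≡ j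
    step     : ∀ i → i < k → fMod N f (c i) ≡ c (modNat k (suc i))

-- cycle C' (in G(f, ℤ_{p^{n+1}})) lies in π⁻¹(C), π = reduction mod p^n;
-- a cycle of the induced subgraph on π⁻¹(C) is exactly such a cycle.
LiesOver : (p n : ℕ) (k : ℕ) (c : ℕ → ℕ) (k' : ℕ) (c' : ℕ → ℕ) → Set
LiesOver p n k c k' c' =
  ∀ j → j < k' → ∃[ i ] (i < k × red (p ^ n) (+ c' j) ≡ c i)

multiplier : Poly → (k : ℕ) → (ℕ → ℕ) → ℤ
multiplier f k c = prodUpTo k (λ i → eval (deriv f) (+ c i))

-- Write N = pⁿ, let x₀ = c′ 0, x₁, … be the orbit of C′ in ℤ_{pN} and y_j the reduction of x_j
-- mod N, which runs around C. As y has period k, x_{j+k} = x_j + T_j N for integers T_j, and a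
-- first-order Taylor expansion of f at x_j (the quadratic term vanishes mod pN because n ≥ 1)
-- gives T_{j+1} ≡ f′(x_j) T_j (mod p). Hence T_{k′} ≡ λ(C′) T₀, while T_{k′} = T₀ because x has
-- period k′. The projection of x returns to its start after k′ steps, so k ∣ k′; if moreover
-- p ∣ T₀ then x_k = x₀, so k′ ∣ k. Thus k′ ≠ k forces p ∤ T₀ and λ(C′) ≡ 1 (mod p), whereas for
-- k′ = k the multiplier λ(C′) = ∏ f′(x_j) is congruent to ∏ f′(y_j) = λ(C) directly.
module Submission where

open import Defs
open import Data.Nat as ℕ using (ℕ; zero; suc; _≤_; _<_; _%_; _/_; _^_; NonZero)
import Data.Nat.Properties as ℕ
import Data.Nat.Divisibility as ℕ
import Data.Nat.DivMod as ℕ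
open import Data.Nat.GeneralisedArithmetic using (fold; fold-+)
open import Data.Nat.Primality using (Prime; euclidsLemma; prime⇒nonZero; prime⇒nonTrivial)
open import Data.Integer using (ℤ; +_; _+_; _*_; _-_; -_; ∣_∣; _%ℕ_; _/ℕ_)
import Data.Integer as ℤ using (NonZero)
import Data.Integer.Properties as ℤ
open import Data.Integer.DivMod using (a≡a%ℕn+[a/ℕn]*n; n%ℕd<d)
open import Data.Integer.Divisibility.Signed
  using ( _∣_; divides; ∣⇒∣ᵤ; ∣ᵤ⇒∣; ∣-trans; ∣m⇒∣-m; ∣m∣n⇒∣m+n; ∣m⇒∣m*n; ∣n⇒∣m*n
        ; *-monoˡ-∣; *-cancelʳ-∣)
open import Data.Integer.Tactic.RingSolver using (solve-∀)
open import Data.List using ([]; _∷_)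
open import Data.Product using (_×_; _,_)
open import Data.Sum using ([_,_]′)
open import Function.Base using (_∘_)
open import Relation.Nullary using (¬_; contradiction)
open import Relation.Binary.Bundles using (Setoid)
open import Relation.Binary.Structures using (IsEquivalence)
open import Relation.Binary.PropositionalEquality
import Relation.Binary.Reasoning.Setoid as SetoidReasoning

-- Congruence is a record rather than a plain definition so that a and b stay inferable.
infix 4 _≡_mod_

record _≡_mod_ (a b m : ℤ) : Set where
  constructor mk≡mod
  field ∣-difference : m ∣ a - b

open _≡_mod_

≡-mod-by-multiple : ∀ {m a b} q → a ≡ b + q * m → a ≡ b mod m
≡-mod-by-multiple {m} {b = b} q refl = mk≡mod (divides q (ring b q m))
  where
  ring : ∀ b q m → (b + q * m) - b ≡ q * m
  ring = solve-∀

module _ {m : ℤ} where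

  ≡-mod-refl : ∀ {a} → a ≡ a mod m
  ≡-mod-refl {a} = ≡-mod-by-multiple (+ 0) (ring a m)
    where
    ring : ∀ a m → a ≡ a + + 0 * m
    ring = solve-∀

  ≡-mod-reflexive : ∀ {a b} → a ≡ b → a ≡ b mod m
  ≡-mod-reflexive refl = ≡-mod-refl

  ≡-mod-sym : ∀ {a b} → a ≡ b mod m → b ≡ a mod m
  ≡-mod-sym {a} {b} (mk≡mod m∣a-b) = mk≡mod (subst (m ∣_) (ring a b) (∣m⇒∣-m m∣a-b))
    where
    ring : ∀ a b → - (a - b) ≡ b - a
    ring = solve-∀

  ≡-mod-trans : ∀ {a b c} → a ≡ b mod m → b ≡ c mod m → a ≡ c mod m
  ≡-mod-trans {a} {b} {c} (mk≡mod m∣a-b) (mk≡mod m∣b-c) =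
    mk≡mod (subst (m ∣_) (ring a b c) (∣m∣n⇒∣m+n m∣a-b m∣b-c))
    where
    ring : ∀ a b c → (a - b) + (b - c) ≡ a - c
    ring = solve-∀

  ≡-mod-isEquivalence : IsEquivalence (_≡_mod m)
  ≡-mod-isEquivalence = record { refl = ≡-mod-refl ; sym = ≡-mod-sym ; trans = ≡-mod-trans }

  +-cong-mod : ∀ {a b c d} → a ≡ b mod m → c ≡ d mod m → a + c ≡ b + d mod m
  +-cong-mod {a} {b} {c} {d} (mk≡mod m∣a-b) (mk≡mod m∣c-d) =
    mk≡mod (subst (m ∣_) (ring a b c d) (∣m∣n⇒∣m+n m∣a-b m∣c-d))
    where
    ring : ∀ a b c d → (a - b) + (c - d) ≡ (a + c) - (b + d)
    ring = solve-∀

  +-congˡ-mod : ∀ a {c d} → c ≡ d mod m → a + c ≡ a + d mod m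
  +-congˡ-mod a = +-cong-mod (≡-mod-refl {a})

  neg-cong-mod : ∀ {a b} → a ≡ b mod m → - a ≡ - b mod m
  neg-cong-mod {a} {b} (mk≡mod m∣a-b) = mk≡mod (subst (m ∣_) (ring a b) (∣m⇒∣-m m∣a-b))
    where
    ring : ∀ a b → - (a - b) ≡ - a - - b
    ring = solve-∀

  *-cong-mod : ∀ {a b c d} → a ≡ b mod m → c ≡ d mod m → a * c ≡ b * d mod m
  *-cong-mod {a} {b} {c} {d} (mk≡mod m∣a-b) (mk≡mod m∣c-d) =
    mk≡mod (subst (m ∣_) (ring a b c d) (∣m∣n⇒∣m+n (∣m⇒∣m*n c m∣a-b) (∣n⇒∣m*n b m∣c-d)))
    where
    ring : ∀ a b c d → (a - b) * c + b * (c - d) ≡ a * c - b * d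
    ring = solve-∀

  *-congˡ-mod : ∀ a {c d} → c ≡ d mod m → a * c ≡ a * d mod m
  *-congˡ-mod a = *-cong-mod (≡-mod-refl {a})

≡-mod-setoid : ℤ → Setoid _ _
≡-mod-setoid m = record { isEquivalence = ≡-mod-isEquivalence {m} }

module ≡-mod-Reasoning (m : ℤ) = SetoidReasoning (≡-mod-setoid m)

≡-mod-weaken : ∀ {d m a b} → d ∣ m → a ≡ b mod m → a ≡ b mod d
≡-mod-weaken d∣m (mk≡mod m∣a-b) = mk≡mod (∣-trans d∣m m∣a-b)

*-cancelʳ-mod : ∀ {p m a b} .{{_ : ℤ.NonZero m}} → a * m ≡ b * m mod p * m → a ≡ b mod p
*-cancelʳ-mod {p} {m} {a} {b} (mk≡mod pm∣am-bm) =
  mk≡mod (*-cancelʳ-∣ m (subst (p * m ∣_) (ring a b m) pm∣am-bm))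
  where
  ring : ∀ a b m → a * m - b * m ≡ (a - b) * m
  ring = solve-∀

t≡a*t⇒a≡1-mod-prime : ∀ {p a t} → Prime p → t ≡ a * t mod + p → ¬ (+ p ∣ t) → a ≡ + 1 mod + p
t≡a*t⇒a≡1-mod-prime {p} {a} {t} p-prime (mk≡mod p∣t-at) p∤t =
  [ mk≡mod ∘ ∣ᵤ⇒∣ , (λ p∣t → contradiction (∣ᵤ⇒∣ p∣t) p∤t) ]′
    (euclidsLemma ∣ a - + 1 ∣ ∣ t ∣ p-prime p∣∣a-1∣∣t∣)
  where
  ring : ∀ a t → - (t - a * t) ≡ (a - + 1) * t
  ring = solve-∀
  p∣∣a-1∣∣t∣ : p ℕ.∣ ∣ a - + 1 ∣ ℕ.* ∣ t ∣
  p∣∣a-1∣∣t∣ = subst (p ℕ.∣_) (ℤ.abs-* (a - + 1) t)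
                 (∣⇒∣ᵤ (subst (+ p ∣_) (ring a t) (∣m⇒∣-m p∣t-at)))

eval-cong-mod : ∀ f {m x y} → x ≡ y mod m → eval f x ≡ eval f y mod m
eval-cong-mod []       x≡y = ≡-mod-refl
eval-cong-mod (a ∷ as) x≡y = +-congˡ-mod a (*-cong-mod x≡y (eval-cong-mod as x≡y))

eval-derivAux-suc : ∀ i bs y → eval (derivAux (suc i) bs) y ≡ eval (derivAux i bs) y + eval bs y
eval-derivAux-suc i []       y = refl
eval-derivAux-suc i (b ∷ bs) y = begin
  + suc i * b + y * eval (derivAux (suc (suc i)) bs) y
    ≡⟨ cong₂ (λ u v → u * b + y * v) (ℤ.pos-+ 1 i) (eval-derivAux-suc (suc i) bs y) ⟩
  (+ 1 + + i) * b + y * (eval (derivAux (suc i) bs) y + eval bs y)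
    ≡⟨ ring (+ i) b y (eval (derivAux (suc i) bs) y) (eval bs y) ⟩
  (+ i * b + y * eval (derivAux (suc i) bs) y) + (b + y * eval bs y) ∎
  where
  open ≡-Reasoning
  ring : ∀ i b y u v → (+ 1 + i) * b + y * (u + v) ≡ (i * b + y * u) + (b + y * v)
  ring = solve-∀

eval-derivAux-0 : ∀ bs y → eval (derivAux 0 bs) y ≡ y * eval (deriv bs) y
eval-derivAux-0 []       y = sym (ℤ.*-zeroʳ y)
eval-derivAux-0 (b ∷ bs) y =
  trans (cong (_+ y * eval (derivAux 1 bs) y) (ℤ.*-zeroˡ b)) (ℤ.+-identityˡ _)

eval-deriv-∷ : ∀ a as y → eval (deriv (a ∷ as)) y ≡ eval as y + y * eval (deriv as) y
eval-deriv-∷ a as y = begin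
  eval (derivAux 1 as) y                ≡⟨ eval-derivAux-suc 0 as y ⟩
  eval (derivAux 0 as) y + eval as y    ≡⟨ cong (_+ eval as y) (eval-derivAux-0 as y) ⟩
  y * eval (deriv as) y + eval as y     ≡⟨ ℤ.+-comm _ (eval as y) ⟩
  eval as y + y * eval (deriv as) y     ∎
  where open ≡-Reasoning

eval-taylor : ∀ f y d → eval f (y + d) ≡ eval f y + eval (deriv f) y * d mod d * d
eval-taylor []      y d = ≡-mod-reflexive (ring d)
  where
  ring : ∀ d → + 0 ≡ + 0 + + 0 * d
  ring = solve-∀
eval-taylor (a ∷ g) y d = begin
  a + (y + d) * eval g (y + d)
    ≈⟨ +-congˡ-mod a (*-congˡ-mod (y + d) (eval-taylor g y d)) ⟩
  a + (y + d) * (eval g y + g′ * d)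
    ≈⟨ ≡-mod-by-multiple g′ (ring a y d (eval g y) g′) ⟩
  (a + y * eval g y) + (eval g y + y * g′) * d
    ≡⟨ cong (λ u → (a + y * eval g y) + u * d) (eval-deriv-∷ a g y) ⟨
  eval (a ∷ g) y + eval (deriv (a ∷ g)) y * d ∎
  where
  open ≡-mod-Reasoning (d * d)
  g′ : ℤ
  g′ = eval (deriv g) y
  ring : ∀ a y d u v → a + (y + d) * (u + v * d) ≡ ((a + y * u) + (u + y * v) * d) + v * (d * d)
  ring = solve-∀

displacement-step : ∀ f {P m x x′ t u u′ t′} .{{_ : ℤ.NonZero m}} → P ∣ m →
  x′ - x ≡ t * m → u ≡ eval f x mod P * m → u′ ≡ eval f x′ mod P * m → u′ - u ≡ t′ * m →
  t′ ≡ eval (deriv f) x * t mod P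
displacement-step f {P} {m} {x} {x′} {t} {u} {u′} {t′} P∣m x′-x≡tm u≡fx u′≡fx′ u′-u≡t′m =
  *-cancelʳ-mod (begin
    t′ * m                                 ≡⟨ u′-u≡t′m ⟨
    u′ - u                                 ≈⟨ +-cong-mod u′≡fx′ (neg-cong-mod u≡fx) ⟩
    eval f x′ - eval f x                   ≡⟨ cong (λ z → eval f z - eval f x) x′≡x+tm ⟩
    eval f (x + t * m) - eval f x          ≈⟨ +-cong-mod taylor ≡-mod-refl ⟩
    (eval f x + f′x * (t * m)) - eval f x  ≡⟨ ring (eval f x) f′x t m ⟩
    f′x * t * m                            ∎)
  where
  open ≡-mod-Reasoning (P * m)
  f′x : ℤ
  f′x = eval (deriv f) x
  ring : ∀ a b t m → (a + b * (t * m)) - a ≡ b * t * m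
  ring = solve-∀
  x′≡x+tm : x′ ≡ x + t * m
  x′≡x+tm = trans (ring′ x′ x) (cong (λ d → x + d) x′-x≡tm)
    where
    ring′ : ∀ x′ x → x′ ≡ x + (x′ - x)
    ring′ = solve-∀
  Pm∣[tm]² : P * m ∣ (t * m) * (t * m)
  Pm∣[tm]² = subst (P * m ∣_) (ring″ t m) (∣n⇒∣m*n (t * t) (*-monoˡ-∣ m P∣m))
    where
    ring″ : ∀ t m → t * t * (m * m) ≡ (t * m) * (t * m)
    ring″ = solve-∀
  taylor : eval f (x + t * m) ≡ eval f x + f′x * (t * m) mod P * m
  taylor = ≡-mod-weaken Pm∣[tm]² (eval-taylor f x (t * m))

red-%ℕ : ∀ N .{{_ : NonZero N}} z → red N z ≡ z %ℕ N
red-%ℕ (suc _) z = refl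

module _ (N : ℕ) .{{_ : NonZero N}} where

  red< : ∀ z → red N z < N
  red< z = subst (_< N) (sym (red-%ℕ N z)) (n%ℕd<d z N)

  ≡-mod-red : ∀ z → z ≡ + red N z mod + N
  ≡-mod-red z = ≡-mod-by-multiple (z /ℕ N)
    (subst (λ r → z ≡ + r + (z /ℕ N) * + N) (sym (red-%ℕ N z)) (a≡a%ℕn+[a/ℕn]*n z N))

  red-small : ∀ {a} → a < N → red N (+ a) ≡ a
  red-small {a} a<N = trans (red-%ℕ N (+ a)) (ℕ.m<n⇒m%n≡m a<N)

  residue-unique : ∀ {r s} → r < N → s < N → + r ≡ + s mod + N → r ≡ s
  residue-unique {r} {s} r<N s<N (mk≡mod N∣r-s) = distance≡0⇒≡ (∣⇒∣ᵤ N∣r-s) distance<N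
    where
    distance<N : ∣ + r - + s ∣ < N
    distance<N = subst (_< N) (cong ∣_∣ (sym (ℤ.m-n≡m⊖n r s)))
                   (ℕ.≤-<-trans (ℤ.∣m⊝n∣≤m⊔n r s) (ℕ.⊔-pres-<m r<N s<N))
    distance≡0⇒≡ : N ℕ.∣ ∣ + r - + s ∣ → ∣ + r - + s ∣ < N → r ≡ s
    distance≡0⇒≡ N∣d d<N with ∣ + r - + s ∣ in eq
    ... | zero  = ℤ.+-injective (ℤ.i-j≡0⇒i≡j (+ r) (+ s) (ℤ.∣i∣≡0⇒i≡0 eq))
    ... | suc _ = contradiction N∣d (ℕ.>⇒∤ d<N)

  red-cong-mod : ∀ {a b} → a ≡ b mod + N → red N a ≡ red N b
  red-cong-mod {a} {b} a≡b = residue-unique (red< a) (red< b)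
    (≡-mod-trans (≡-mod-sym (≡-mod-red a)) (≡-mod-trans a≡b (≡-mod-red b)))

module _ {N N′ : ℕ} .{{_ : NonZero N}} .{{_ : NonZero N′}} (N∣N′ : N ℕ.∣ N′) (f : Poly) where

  red-fMod : ∀ v → red N (+ fMod N′ f v) ≡ fMod N f (red N (+ v))
  red-fMod v = red-cong-mod N (≡-mod-trans
    (≡-mod-weaken (∣ᵤ⇒∣ N∣N′) (≡-mod-sym (≡-mod-red N′ (eval f (+ v)))))
    (eval-cong-mod f (≡-mod-red N (+ v))))

  red-fold-fMod : ∀ v j → red N (+ fold v (fMod N′ f) j) ≡ fold (red N (+ v)) (fMod N f) j
  red-fold-fMod v zero    = refl
  red-fold-fMod v (suc j) =
    trans (red-fMod (fold v (fMod N′ f) j)) (cong (fMod N f) (red-fold-fMod v j))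

prodUpTo-cong : ∀ k {g h : ℕ → ℤ} → (∀ j → j < k → g j ≡ h j) → prodUpTo k g ≡ prodUpTo k h
prodUpTo-cong zero    g≡h = refl
prodUpTo-cong (suc k) g≡h =
  cong₂ _*_ (prodUpTo-cong k (λ j j<k → g≡h j (ℕ.m<n⇒m<1+n j<k))) (g≡h k ℕ.≤-refl)

prodUpTo-cong-mod : ∀ k {m} {g h : ℕ → ℤ} → (∀ j → j < k → g j ≡ h j mod m) →
                    prodUpTo k g ≡ prodUpTo k h mod m
prodUpTo-cong-mod zero    g≡h = ≡-mod-refl
prodUpTo-cong-mod (suc k) g≡h =
  *-cong-mod (prodUpTo-cong-mod k (λ j j<k → g≡h j (ℕ.m<n⇒m<1+n j<k))) (g≡h k ℕ.≤-refl)

prodUpTo-suc : ∀ k (s : ℕ → ℤ) → prodUpTo (suc k) s ≡ s 0 * prodUpTo k (s ∘ suc)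
prodUpTo-suc zero    s = trans (ℤ.*-identityˡ (s 0)) (sym (ℤ.*-identityʳ (s 0)))
prodUpTo-suc (suc k) s =
  trans (cong (_* s (suc k)) (prodUpTo-suc k s)) (ℤ.*-assoc (s 0) _ (s (suc k)))

prodUpTo-shift : ∀ k (s : ℕ → ℤ) → s k ≡ s 0 → prodUpTo k (s ∘ suc) ≡ prodUpTo k s
prodUpTo-shift zero    s sk≡s0 = refl
prodUpTo-shift (suc k) s sk≡s0 = begin
  prodUpTo k (s ∘ suc) * s (suc k)  ≡⟨ cong (prodUpTo k (s ∘ suc) *_) sk≡s0 ⟩
  prodUpTo k (s ∘ suc) * s 0        ≡⟨ ℤ.*-comm _ (s 0) ⟩
  s 0 * prodUpTo k (s ∘ suc)        ≡⟨ prodUpTo-suc k s ⟨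
  prodUpTo (suc k) s                ∎
  where open ≡-Reasoning

prodUpTo-rotate : ∀ k (s : ℕ → ℤ) → (∀ j → s (j ℕ.+ k) ≡ s j) →
                  ∀ i → prodUpTo k (λ j → s (j ℕ.+ i)) ≡ prodUpTo k s
prodUpTo-rotate k s periodic zero    = prodUpTo-cong k (λ j _ → cong s (ℕ.+-identityʳ j))
prodUpTo-rotate k s periodic (suc i) = begin
  prodUpTo k (λ j → s (j ℕ.+ suc i))  ≡⟨ prodUpTo-cong k (λ j _ → cong s (ℕ.+-suc j i)) ⟩
  prodUpTo k (λ j → s (suc j ℕ.+ i))  ≡⟨ prodUpTo-shift k (λ j → s (j ℕ.+ i)) sₖ₊ᵢ≡sᵢ ⟩
  prodUpTo k (λ j → s (j ℕ.+ i))      ≡⟨ prodUpTo-rotate k s periodic i ⟩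
  prodUpTo k s                        ∎
  where
  open ≡-Reasoning
  sₖ₊ᵢ≡sᵢ : s (k ℕ.+ i) ≡ s (0 ℕ.+ i)
  sₖ₊ᵢ≡sᵢ = trans (cong s (ℕ.+-comm k i)) (periodic i)

prodUpTo-recurrence : ∀ {m} (t d : ℕ → ℤ) → (∀ j → t (suc j) ≡ d j * t j mod m) →
                      ∀ j → t j ≡ prodUpTo j d * t 0 mod m
prodUpTo-recurrence     t d step zero    = ≡-mod-reflexive (sym (ℤ.*-identityˡ (t 0)))
prodUpTo-recurrence {m} t d step (suc j) = begin
  t (suc j)                   ≈⟨ step j ⟩
  d j * t j                   ≈⟨ *-congˡ-mod (d j) (prodUpTo-recurrence t d step j) ⟩
  d j * (prodUpTo j d * t 0)  ≡⟨ ring (d j) (prodUpTo j d) (t 0) ⟩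
  prodUpTo j d * d j * t 0    ∎
  where
  open ≡-mod-Reasoning m
  ring : ∀ a b c → a * (b * c) ≡ b * a * c
  ring = solve-∀

modNat-% : ∀ k .{{_ : NonZero k}} i → modNat k i ≡ i % k
modNat-% (suc _) i = refl

[1+m%n]%n≡[1+m]%n : ∀ m n .{{_ : NonZero n}} → suc (m % n) % n ≡ suc m % n
[1+m%n]%n≡[1+m]%n m n = begin
  (1 ℕ.+ m % n) % n          ≡⟨ ℕ.%-distribˡ-+ 1 (m % n) n ⟩
  (1 % n ℕ.+ m % n % n) % n  ≡⟨ cong (λ r → (1 % n ℕ.+ r) % n) (ℕ.m%n%n≡m%n m n) ⟩
  (1 % n ℕ.+ m % n) % n      ≡⟨ ℕ.%-distribˡ-+ 1 m n ⟨
  (1 ℕ.+ m) % n              ∎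
  where open ≡-Reasoning

module _ {N f k c} (C : IsCycle N f k c) where

  open IsCycle C

  private
    instance
      k≢0 : NonZero k
      k≢0 = ℕ.>-nonZero size-pos

  cycle-orbit : ∀ {i} → i < k → ∀ j → fold (c i) (fMod N f) j ≡ c ((i ℕ.+ j) % k)
  cycle-orbit {i} i<k zero    =
    cong c (sym (trans (cong (_% k) (ℕ.+-identityʳ i)) (ℕ.m<n⇒m%n≡m i<k)))
  cycle-orbit {i} i<k (suc j) = begin
    fMod N f (fold (c i) (fMod N f) j)  ≡⟨ cong (fMod N f) (cycle-orbit i<k j) ⟩
    fMod N f (c ((i ℕ.+ j) % k))        ≡⟨ step _ (ℕ.m%n<n (i ℕ.+ j) k) ⟩
    c (modNat k (suc ((i ℕ.+ j) % k)))  ≡⟨ cong c (modNat-% k _) ⟩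
    c (suc ((i ℕ.+ j) % k) % k)         ≡⟨ cong c ([1+m%n]%n≡[1+m]%n (i ℕ.+ j) k) ⟩
    c (suc (i ℕ.+ j) % k)               ≡⟨ cong (λ a → c (a % k)) (ℕ.+-suc i j) ⟨
    c ((i ℕ.+ suc j) % k)               ∎
    where open ≡-Reasoning

  cycle-orbit-< : ∀ {i} → i < k → ∀ j → fold (c i) (fMod N f) j < N
  cycle-orbit-< {i} i<k j =
    subst (_< N) (sym (cycle-orbit i<k j)) (inRange _ (ℕ.m%n<n (i ℕ.+ j) k))

  cycle-orbit-0 : ∀ {j} → j < k → fold (c 0) (fMod N f) j ≡ c j
  cycle-orbit-0 {j} j<k = trans (cycle-orbit size-pos j) (cong c (ℕ.m<n⇒m%n≡m j<k))

  cycle-period : ∀ {i} → i < k → fold (c i) (fMod N f) k ≡ c i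
  cycle-period {i} i<k =
    trans (cycle-orbit i<k k) (cong c (trans (ℕ.[m+n]%n≡m%n i k) (ℕ.m<n⇒m%n≡m i<k)))

  cycle-return⇒∣ : ∀ {i j} → i < k → fold (c i) (fMod N f) j ≡ c i → k ℕ.∣ j
  cycle-return⇒∣ {i} {j} i<k returns = ℕ.divides q (ℕ.+-cancelˡ-≡ i j (q ℕ.* k) i+j≡i+q*k)
    where
    q : ℕ
    q = (i ℕ.+ j) / k
    [i+j]%k≡i : (i ℕ.+ j) % k ≡ i
    [i+j]%k≡i =
      distinct _ _ (ℕ.m%n<n (i ℕ.+ j) k) i<k (trans (sym (cycle-orbit i<k j)) returns)
    i+j≡i+q*k : i ℕ.+ j ≡ i ℕ.+ q ℕ.* k
    i+j≡i+q*k = trans (ℕ.m≡m%n+[m/n]*n (i ℕ.+ j) k) (cong (ℕ._+ q ℕ.* k) [i+j]%k≡i)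

  multiplier-orbit : ∀ {i} → i < k →
    multiplier f k c ≡ prodUpTo k (λ j → eval (deriv f) (+ fold (c i) (fMod N f) j))
  multiplier-orbit {i} i<k = begin
    multiplier f k c                   ≡⟨ prodUpTo-cong k (λ j → cong (f′ ∘ +_) ∘ cycle-orbit-0) ⟨
    prodUpTo k s                       ≡⟨ prodUpTo-rotate k s s-periodic i ⟨
    prodUpTo k (λ j → s (j ℕ.+ i))     ≡⟨ prodUpTo-cong k (λ j _ → cong (f′ ∘ +_) (orbit-via j)) ⟩
    prodUpTo k (λ j → f′ (+ fold (c i) g j)) ∎
    where
    open ≡-Reasoning
    f′ : ℤ → ℤ
    f′ = eval (deriv f)
    g : ℕ → ℕ
    g = fMod N f
    s : ℕ → ℤ
    s j = f′ (+ fold (c 0) g j)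
    orbit-via : ∀ j → fold (c 0) g (j ℕ.+ i) ≡ fold (c i) g j
    orbit-via j = trans (fold-+ (c 0) g j) (cong (λ v → fold v g j) (cycle-orbit-0 i<k))
    s-periodic : ∀ j → s (j ℕ.+ k) ≡ s j
    s-periodic j = cong (f′ ∘ +_)
      (trans (fold-+ (c 0) g j) (cong (λ v → fold v g j) (cycle-period size-pos)))

module LiftedCycle {p} (p-prime : Prime p) (n : ℕ) (f : Poly)
  {k c} (C : IsCycle (p ^ suc n) f k c) {k′ c′} (C′ : IsCycle (p ^ suc (suc n)) f k′ c′)
  {i} (i<k : i < k) (c′0-over-ci : red (p ^ suc n) (+ c′ 0) ≡ c i) where

  private
    N : ℕ
    N = p ^ suc n

    instance
      p≢0 : NonZero p
      p≢0 = prime⇒nonZero p-prime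
      N≢0 : NonZero N
      N≢0 = ℕ.m^n≢0 p (suc n)
      pN≢0 : NonZero (p ℕ.* N)
      pN≢0 = ℕ.m^n≢0 p (suc (suc n))

    f′ : ℤ → ℤ
    f′ = eval (deriv f)

    0<k′ : 0 < k′
    0<k′ = IsCycle.size-pos C′

    F : ℕ → ℕ
    F = fMod (p ℕ.* N) f

    x : ℕ → ℕ
    x j = fold (c′ 0) F j

    y : ℕ → ℕ
    y j = fold (c i) (fMod N f) j

    p∣N : + p ∣ + N
    p∣N = ∣ᵤ⇒∣ (ℕ.m∣m*n (p ^ n))

    red-x : ∀ j → red N (+ x j) ≡ y j
    red-x j = trans (red-fold-fMod (ℕ.n∣m*n p) f (c′ 0) j)
                    (cong (λ v → fold v (fMod N f) j) c′0-over-ci)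

    x≡y : ∀ j → + x j ≡ + y j mod + N
    x≡y j = subst (λ v → + x j ≡ + v mod + N) (red-x j) (≡-mod-red N (+ x j))

    x-period : x k′ ≡ x 0
    x-period = cycle-period C′ 0<k′

    k∣k′ : k ℕ.∣ k′
    k∣k′ = cycle-return⇒∣ C i<k
      (trans (sym (red-x k′)) (trans (cong (red N ∘ +_) x-period) (red-x 0)))

    x-shift : ∀ j → + x (j ℕ.+ k) ≡ + x j mod + N
    x-shift j = ≡-mod-trans (x≡y (j ℕ.+ k))
      (≡-mod-trans (≡-mod-reflexive (cong +_ y-shift)) (≡-mod-sym (x≡y j)))
      where
      y-shift : y (j ℕ.+ k) ≡ y j
      y-shift = trans (fold-+ (c i) (fMod N f) j)
                      (cong (λ v → fold v (fMod N f) j) (cycle-period C i<k))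

    T : ℕ → ℤ
    T j = _∣_.quotient (∣-difference (x-shift j))

    T-spec : ∀ j → + x (j ℕ.+ k) - + x j ≡ T j * + N
    T-spec j = _∣_.equality (∣-difference (x-shift j))

    F-≡ : ∀ v → + F v ≡ eval f (+ v) mod + p * + N
    F-≡ v = subst (λ m → + F v ≡ eval f (+ v) mod m) (ℤ.pos-* p N)
              (≡-mod-sym (≡-mod-red (p ℕ.* N) (eval f (+ v))))

    T-step : ∀ j → T (suc j) ≡ f′ (+ x j) * T j mod + p
    T-step j =
      displacement-step f p∣N (T-spec j) (F-≡ (x j)) (F-≡ (x (j ℕ.+ k))) (T-spec (suc j))

    T-period : T k′ ≡ T 0
    T-period = ℤ.*-cancelʳ-≡ (T k′) (T 0) (+ N) (begin
      T k′ * + N              ≡⟨ T-spec k′ ⟨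
      + x (k′ ℕ.+ k) - + x k′ ≡⟨ cong₂ (λ a b → + a - + b) x[k′+k]≡x[k] x-period ⟩
      + x k - + x 0           ≡⟨ T-spec 0 ⟩
      T 0 * + N               ∎)
      where
      open ≡-Reasoning
      x[k′+k]≡x[k] : x (k′ ℕ.+ k) ≡ x k
      x[k′+k]≡x[k] = trans (cong x (ℕ.+-comm k′ k))
        (trans (fold-+ (c′ 0) F k) (cong (λ v → fold v F k) x-period))

    T0-not-divisible : k′ ≢ k → ¬ (+ p ∣ T 0)
    T0-not-divisible k′≢k p∣T0 = k′≢k (ℕ.∣-antisym k′∣k k∣k′)
      where
      x[k]≡x[0] : + x k ≡ + x 0 mod + (p ℕ.* N)
      x[k]≡x[0] = mk≡mod (subst₂ _∣_ (sym (ℤ.pos-* p N)) (sym (T-spec 0)) (*-monoˡ-∣ (+ N) p∣T0))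
      k′∣k : k′ ℕ.∣ k
      k′∣k = cycle-return⇒∣ C′ 0<k′
        (residue-unique (p ℕ.* N) (cycle-orbit-< C′ 0<k′ k) (cycle-orbit-< C′ 0<k′ 0) x[k]≡x[0])

    multiplier′-orbit : multiplier f k′ c′ ≡ prodUpTo k′ (f′ ∘ +_ ∘ x)
    multiplier′-orbit = multiplier-orbit C′ 0<k′

  same-size⇒multipliers≡ : k′ ≡ k → red p (multiplier f k′ c′) ≡ red p (multiplier f k c)
  same-size⇒multipliers≡ k′≡k = red-cong-mod p (begin
    multiplier f k′ c′          ≡⟨ multiplier′-orbit ⟩
    prodUpTo k′ (f′ ∘ +_ ∘ x)   ≈⟨ prodUpTo-cong-mod k′ (λ j _ → f′x≡f′y j) ⟩
    prodUpTo k′ (f′ ∘ +_ ∘ y)   ≡⟨ cong (λ l → prodUpTo l (f′ ∘ +_ ∘ y)) k′≡k ⟩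
    prodUpTo k (f′ ∘ +_ ∘ y)    ≡⟨ multiplier-orbit C i<k ⟨
    multiplier f k c            ∎)
    where
    open ≡-mod-Reasoning (+ p)
    f′x≡f′y : ∀ j → f′ (+ x j) ≡ f′ (+ y j) mod + p
    f′x≡f′y j = eval-cong-mod (deriv f) (≡-mod-weaken p∣N (x≡y j))

  different-size⇒multiplier≡1 : k′ ≢ k → red p (multiplier f k′ c′) ≡ 1
  different-size⇒multiplier≡1 k′≢k = begin
    red p (multiplier f k′ c′)  ≡⟨ cong (red p) multiplier′-orbit ⟩
    red p λ′                    ≡⟨ red-cong-mod p λ′≡1 ⟩
    red p (+ 1)                 ≡⟨ red-small p (ℕ.nonTrivial⇒n>1 p {{prime⇒nonTrivial p-prime}}) ⟩
    1                           ∎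
    where
    open ≡-Reasoning
    λ′ : ℤ
    λ′ = prodUpTo k′ (f′ ∘ +_ ∘ x)
    T0≡λ′T0 : T 0 ≡ λ′ * T 0 mod + p
    T0≡λ′T0 = subst (_≡ λ′ * T 0 mod + p) T-period
                (prodUpTo-recurrence T (f′ ∘ +_ ∘ x) T-step k′)
    λ′≡1 : λ′ ≡ + 1 mod + p
    λ′≡1 = t≡a*t⇒a≡1-mod-prime p-prime T0≡λ′T0 (T0-not-divisible k′≢k)

lemma4p9 : (p : ℕ) → Prime p → (n : ℕ) → 1 ≤ n → (f : Poly)
         → (k : ℕ) (c : ℕ → ℕ) → IsCycle (p ^ n) f k c
         → (k' : ℕ) (c' : ℕ → ℕ) → IsCycle (p ^ suc n) f k' c'
         → LiesOver p n k c k' c'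
         → (k' ≡ k → red p (multiplier f k' c') ≡ red p (multiplier f k c))
         × (k' ≢ k → red p (multiplier f k' c') ≡ 1)
lemma4p9 p p-prime (suc n) _ f k c C k′ c′ C′ over
  with i , i<k , c′0-over-ci ← over 0 (IsCycle.size-pos C′) =
  same-size⇒multipliers≡ , different-size⇒multiplier≡1
  where open LiftedCycle p-prime n f C C′ i<k c′0-over-ci
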